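{- Let $G$ be a finite simple graph whose edge clique cover number is $2$, so that $G=K_{V_1}\cup K_{V_2}$ for two maximal cliques with vertex sets $V_1,V_2$. Let $K_{V_1V_2}=G[V_1\cap V_2]$, and let $\|K_{V_1}\|=|V_1\setminus V_2|$, $\|K_{V_2}\|=|V_2\setminus V_1|$. Then $$\big(|G|-|K_{V_1V_2}|\big)\,\mathrm{dim}\,G=\|K_{V_1}\|\,\mathrm{dim}\,K_{V_1}+\|K_{V_2}\|\,\mathrm{dim}\,K_{V_2}.$$
   Context: For a vertex set $V$, $K_V$ denotes the complete graph on $V$; $G[W]$ is the subgraph induced on $W$; $|H|$ is the number of vertices of $H$. An edge clique cover of $G$ is a set of cliques whose edge sets together cover all edges of $G$; the edge clique cover number is the minimum size of such a set. For a vertex $v$, $S_G(v)$ is the subgraph induced on the neighbors of $v$. The inductive dimension is defined recursively: $\mathrm{dim}\,H=-1$ if $H$ is empty; otherwise $\mathrm{dim}\,H=\frac{1}{|H|}\sum_{v}\mathrm{dim}_H(v)$ with $\mathrm{dim}_H(v)=1+\mathrm{dim}\,S_H(v)$. (In particular $\mathrm{dim}\,K_N=N-1$.) -}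

module Defs where

open import Data.Nat as ℕ using (ℕ; zero; suc; _∸_)
open import Data.Integer as ℤ using (+_; -[1+_])
open import Data.Fin using (Fin; zero; suc)
open import Data.Fin.Subset using (Subset; ⊤; _∩_; _∪_; ∣_∣; _∈_; _∉_; _─_)
open import Data.Bool using (Bool; true; false; if_then_else_; _∧_)
open import Data.Vec using (Vec; lookup; tabulate)
open import Data.List using (List; length)
open import Data.List.Relation.Unary.All using (All)
open import Data.List.Relation.Unary.Any using (Any)
open import Data.Product using (Σ; _×_; ∃)
open import Data.Rational using (ℚ; _+_; _*_; _/_; 0ℚ; 1ℚ)
open import Relation.Binary.PropositionalEquality using (_≡_; _≢_)
open import Relation.Nullary using (¬_)

record Graph (n : ℕ) : Set where
  field
    adj    : Fin n → Fin n → Bool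
    sym    : ∀ u v → adj u v ≡ adj v u
    irrefl : ∀ v → adj v v ≡ false
open Graph public

-- The complete graph on Fin n; K_V is the subgraph of it induced on V.
complete : (n : ℕ) → Graph n
complete n = record { adj = adjK ; sym = symK ; irrefl = irrK }
  where
  eqb : ∀ {m} → Fin m → Fin m → Bool
  eqb zero zero = true
  eqb zero (suc _) = false
  eqb (suc _) zero = false
  eqb (suc a) (suc b) = eqb a b
  adjK : Fin n → Fin n → Bool
  adjK u v = if eqb u v then false else true
  eqb-sym : ∀ {m} (a b : Fin m) → eqb a b ≡ eqb b a
  eqb-sym zero zero = _≡_.refl
  eqb-sym zero (suc _) = _≡_.refl
  eqb-sym (suc _) zero = _≡_.refl
  eqb-sym (suc a) (suc b) = eqb-sym a b
  symK : ∀ u v → adjK u v ≡ adjK v u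
  symK u v rewrite eqb-sym u v = _≡_.refl
  eqb-refl : ∀ {m} (a : Fin m) → eqb a a ≡ true
  eqb-refl zero = _≡_.refl
  eqb-refl (suc a) = eqb-refl a
  irrK : ∀ v → adjK v v ≡ false
  irrK v rewrite eqb-refl v = _≡_.refl

nbhd : ∀ {n} → Graph n → Fin n → Subset n
nbhd G v = tabulate (adj G v)

sumFin : (n : ℕ) → (Fin n → ℚ) → ℚ
sumFin zero    f = 0ℚ
sumFin (suc n) f = f zero + sumFin n (λ i → f (suc i))

-1ℚ : ℚ
-1ℚ = -[1+ 0 ] / 1

ℕ→ℚ : ℕ → ℚ
ℕ→ℚ k = + k / 1

-- The neighbour set W ∩ N(v) has strictly
-- fewer vertices than W (v ∉ N(v)), so fuel ≥ |W| suffices.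
dimFuel : ∀ {n} → ℕ → Graph n → Subset n → ℚ
dimFuel zero    G W = -1ℚ
dimFuel {n} (suc f) G W with ∣ W ∣
... | zero  = -1ℚ
... | suc k = sumFin n term * (+ 1 / suc k)
  where
  term : Fin n → ℚ
  term v = if lookup W v then 1ℚ + dimFuel f G (W ∩ nbhd G v) else 0ℚ

dimInduced : ∀ {n} → Graph n → Subset n → ℚ
dimInduced {n} G W = dimFuel n G W

dim : ∀ {n} → Graph n → ℚ
dim G = dimInduced G ⊤

dimK : ∀ {n} → Subset n → ℚ
dimK {n} V = dimInduced (complete n) V

IsClique : ∀ {n} → Graph n → Subset n → Set
IsClique G C = ∀ u v → u ∈ C → v ∈ C → u ≢ v → adj G u v ≡ true

IsMaximalClique : ∀ {n} → Graph n → Subset n → Set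
IsMaximalClique {n} G C =
  IsClique G C × (∀ (D : Subset n) → IsClique G D → (∀ x → x ∈ C → x ∈ D) → ∀ x → x ∈ D → x ∈ C)

IsEdgeCliqueCover : ∀ {n} → Graph n → List (Subset n) → Set
IsEdgeCliqueCover G cs =
  All (IsClique G) cs × (∀ u v → adj G u v ≡ true → Any (λ C → u ∈ C × v ∈ C) cs)

EdgeCliqueCoverNumber : ∀ {n} → Graph n → ℕ → Set
EdgeCliqueCoverNumber {n} G k =
  (Σ (List (Subset n)) λ cs → IsEdgeCliqueCover G cs × length cs ≡ k)
  × (∀ cs → IsEdgeCliqueCover G cs → k ℕ.≤ length cs)

-- Split the vertices into the shared part V₁ ∩ V₂ and the private parts V₁ ─ V₂ and V₂ ─ V₁,
-- and write a, b, c for their sizes inside a vertex set W.  In G[W] a private vertex of V₁ sees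
-- exactly the clique W ∩ V₁ minus itself, so it contributes |W ∩ V₁| − 1 to the average defining
-- dim G[W], and symmetrically for V₂; a shared vertex v sees all of W − v, a graph of the same
-- kind with the same private parts.  Induction on |W| thus gives
--   (b + c) · dim G[W] = b · (|W ∩ V₁| − 1) + c · (|W ∩ V₂| − 1):
-- after multiplying the average by b + c, the a shared vertices contribute the right-hand side each
-- by induction, and the b + c private ones contribute b + c times it in total.  For W = V this is
-- the theorem, as dim K_{Vᵢ} = |Vᵢ| − 1.

module Submission where

open import Defs hiding (sym)
open import Data.Nat using (ℕ; _∸_)
open import Data.Fin.Subset using (Subset; ∣_∣; _∩_; _─_; _∈_)
open import Data.Fin using (Fin)
open import Data.Product using (_×_)
open import Data.Sum using (_⊎_)
open import Data.Bool using (true)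
open import Data.Rational using (_+_; _*_)
open import Relation.Binary.PropositionalEquality using (_≡_)

open import Data.Nat as ℕ using (suc; _≤_)
import Data.Nat.Properties as ℕ
open import Data.Nat.Coprimality using (1-coprimeTo) renaming (sym to coprime-sym)
import Data.Integer as ℤ
import Data.Integer.Properties as ℤ
open import Data.Fin using (zero; suc)
open import Data.Fin.Subset using (_∉_; _⊆_; _-_; ⊤; ⁅_⁆; inside; outside)
open import Data.Fin.Subset.Properties
  using (⊆-antisym; p─q⊆p; p∩q⊆q; x∈p∩q⁺; x∈p∩q⁻; x∈p∧x∉q⇒x∈p─q; x∈p∧x≢y⇒x∈p-y; x∉⁅y⁆⇒x≢y;
         x∈p⇒∣p-x∣<∣p∣; p─⊥≡p; p─q─r≡p─r─q; ∩-identityˡ; ∣p∣≤n; ∣⊤∣≡n; ∣p∩q∣≤∣p∣)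
open import Data.Bool using (if_then_else_)
open import Data.Vec using ([]; _∷_; here; there; lookup)
open import Data.Vec.Properties using (lookup∘tabulate; []=⇒lookup; lookup⇒[]=)
open import Data.Rational using (ℚ; mkℚ; 0ℚ; 1ℚ; _/_)
import Data.Rational.Properties as ℚ
import Data.Rational.Solver as ℚ-Solver
open import Data.Sum using (inj₁; inj₂) renaming (swap to ⊎-swap)
open import Data.Product using (_,_; proj₁; proj₂)
open import Function using (_∘_)
open import Relation.Nullary using (contradiction)
open import Relation.Binary.PropositionalEquality
  using (refl; sym; trans; cong; cong₂; subst; _≢_; ≢-sym; module ≡-Reasoning)

open ≡-Reasoning
open ℚ-Solver.+-*-Solver using (solve; _:+_; _:*_; _:=_; con)

private
  variable
    n : ℕ

ℕ→ℚ≡mkℚ : ∀ k → ℕ→ℚ k ≡ mkℚ (ℤ.+ k) 0 (coprime-sym (1-coprimeTo k))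
ℕ→ℚ≡mkℚ k = ℚ.normalize-coprime (coprime-sym (1-coprimeTo k))

ℕ→ℚ-suc : ∀ k → ℕ→ℚ (suc k) ≡ 1ℚ + ℕ→ℚ k
ℕ→ℚ-suc k rewrite ℕ→ℚ≡mkℚ k =
  ℚ./-cong (cong (λ z → ℤ.+ 1 ℤ.+ z) (sym (ℤ.*-identityʳ (ℤ.+ k)))) refl

ℕ→ℚ-+ : ∀ m k → ℕ→ℚ (m ℕ.+ k) ≡ ℕ→ℚ m + ℕ→ℚ k
ℕ→ℚ-+ ℕ.zero k = sym (ℚ.+-identityˡ (ℕ→ℚ k))
ℕ→ℚ-+ (suc m) k = begin
  ℕ→ℚ (suc (m ℕ.+ k))            ≡⟨ ℕ→ℚ-suc (m ℕ.+ k) ⟩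
  1ℚ + ℕ→ℚ (m ℕ.+ k)             ≡⟨ cong (1ℚ +_) (ℕ→ℚ-+ m k) ⟩
  1ℚ + (ℕ→ℚ m + ℕ→ℚ k)           ≡⟨ sym (ℚ.+-assoc 1ℚ (ℕ→ℚ m) (ℕ→ℚ k)) ⟩
  (1ℚ + ℕ→ℚ m) + ℕ→ℚ k           ≡⟨ cong (_+ ℕ→ℚ k) (sym (ℕ→ℚ-suc m)) ⟩
  ℕ→ℚ (suc m) + ℕ→ℚ k            ∎

ℕ→ℚ-suc-*-inverse : ∀ k → ℕ→ℚ (suc k) * (ℤ.+ 1 / suc k) ≡ 1ℚ
ℕ→ℚ-suc-*-inverse k
  rewrite ℕ→ℚ≡mkℚ (suc k) | ℚ.normalize-coprime {1} {k} (1-coprimeTo (suc k)) =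
  ℚ.*-inverseʳ (mkℚ (ℤ.+ suc k) 0 (coprime-sym (1-coprimeTo (suc k))))

ℕ→ℚ-suc-*-cancelˡ : ∀ k {x y} → ℕ→ℚ (suc k) * x ≡ ℕ→ℚ (suc k) * y → x ≡ y
ℕ→ℚ-suc-*-cancelˡ k {x} {y} eq = trans (sym (undo x)) (trans (cong (r *_) eq) (undo y))
  where
  r = ℤ.+ 1 / suc k
  undo : ∀ z → r * (ℕ→ℚ (suc k) * z) ≡ z
  undo z = begin
    r * (ℕ→ℚ (suc k) * z)   ≡⟨ solve 3 (λ r K z → r :* (K :* z) := (K :* r) :* z) refl r (ℕ→ℚ (suc k)) z ⟩
    (ℕ→ℚ (suc k) * r) * z   ≡⟨ cong (_* z) (ℕ→ℚ-suc-*-inverse k) ⟩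
    1ℚ * z                  ≡⟨ ℚ.*-identityˡ z ⟩
    z                       ∎

x∈p─q⇒x∉q : ∀ {p q : Subset n} {x} → x ∈ p ─ q → x ∉ q
x∈p─q⇒x∉q {p = _ ∷ _} {outside ∷ _} here          ()
x∈p─q⇒x∉q {p = _ ∷ _} {_ ∷ _}       (there x∈p─q) (there x∈q) = x∈p─q⇒x∉q x∈p─q x∈q

x∈p-y⇒x≢y : ∀ {p : Subset n} {x y} → x ∈ p - y → x ≢ y
x∈p-y⇒x≢y = x∉⁅y⁆⇒x≢y ∘ x∈p─q⇒x∉q

x∉p⇒p-x≡p : ∀ {p : Subset n} {x} → x ∉ p → p - x ≡ p
x∉p⇒p-x≡p {p = p} {x} x∉p =
  ⊆-antisym (p─q⊆p p ⁅ x ⁆) (λ y∈p → x∈p∧x≢y⇒x∈p-y y∈p λ { refl → x∉p y∈p })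

x∈p⇒suc∣p-x∣≡∣p∣ : ∀ {p : Subset n} {x} → x ∈ p → suc ∣ p - x ∣ ≡ ∣ p ∣
x∈p⇒suc∣p-x∣≡∣p∣ {p = inside ∷ p}  here        = cong (suc ∘ ∣_∣) (p─⊥≡p p)
x∈p⇒suc∣p-x∣≡∣p∣ {p = inside ∷ _}  (there x∈p) = cong suc (x∈p⇒suc∣p-x∣≡∣p∣ x∈p)
x∈p⇒suc∣p-x∣≡∣p∣ {p = outside ∷ _} (there x∈p) = x∈p⇒suc∣p-x∣≡∣p∣ x∈p

[p─r]∩q≡p∩q─r : ∀ (p r q : Subset n) → (p ─ r) ∩ q ≡ p ∩ q ─ r
[p─r]∩q≡p∩q─r []      []            []      = refl
[p─r]∩q≡p∩q─r (_ ∷ p) (inside ∷ r)  (_ ∷ q) = cong (outside ∷_) ([p─r]∩q≡p∩q─r p r q)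
[p─r]∩q≡p∩q─r (s ∷ p) (outside ∷ r) (t ∷ q) = cong (_ ∷_) ([p─r]∩q≡p∩q─r p r q)

∣p∣≡∣p∩q∣+∣p─q∣ : ∀ (p q : Subset n) → ∣ p ∣ ≡ ∣ p ∩ q ∣ ℕ.+ ∣ p ─ q ∣
∣p∣≡∣p∩q∣+∣p─q∣ []            []            = refl
∣p∣≡∣p∩q∣+∣p─q∣ (outside ∷ p) (inside ∷ q)  = ∣p∣≡∣p∩q∣+∣p─q∣ p q
∣p∣≡∣p∩q∣+∣p─q∣ (outside ∷ p) (outside ∷ q) = ∣p∣≡∣p∩q∣+∣p─q∣ p q
∣p∣≡∣p∩q∣+∣p─q∣ (inside ∷ p)  (inside ∷ q)  = cong suc (∣p∣≡∣p∩q∣+∣p─q∣ p q)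
∣p∣≡∣p∩q∣+∣p─q∣ (inside ∷ p)  (outside ∷ q) =
  trans (cong suc (∣p∣≡∣p∩q∣+∣p─q∣ p q)) (sym (ℕ.+-suc ∣ p ∩ q ∣ ∣ p ─ q ∣))

x∈p∧∣p∣≤1+m⇒∣p-x∣≤m : ∀ {p : Subset n} {x m} → x ∈ p → ∣ p ∣ ≤ suc m → ∣ p - x ∣ ≤ m
x∈p∧∣p∣≤1+m⇒∣p-x∣≤m x∈p ∣p∣≤ = ℕ.≤-pred (ℕ.≤-trans (x∈p⇒∣p-x∣<∣p∣ x∈p) ∣p∣≤)

x∈p∩q⇒suc∣[p-x]∩q∣≡∣p∩q∣ : ∀ (p q : Subset n) {x} → x ∈ p ∩ q → suc ∣ (p - x) ∩ q ∣ ≡ ∣ p ∩ q ∣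
x∈p∩q⇒suc∣[p-x]∩q∣≡∣p∩q∣ p q {x} x∈p∩q =
  trans (cong (suc ∘ ∣_∣) ([p─r]∩q≡p∩q─r p ⁅ x ⁆ q)) (x∈p⇒suc∣p-x∣≡∣p∣ x∈p∩q)

x∈r⇒[p-x]∩q─r≡p∩q─r : ∀ (p q r : Subset n) {x} → x ∈ r → (p - x) ∩ q ─ r ≡ p ∩ q ─ r
x∈r⇒[p-x]∩q─r≡p∩q─r p q r {x} x∈r = begin
  (p - x) ∩ q ─ r      ≡⟨ cong (_─ r) ([p─r]∩q≡p∩q─r p ⁅ x ⁆ q) ⟩
  p ∩ q - x ─ r        ≡⟨ p─q─r≡p─r─q (p ∩ q) ⁅ x ⁆ r ⟩
  p ∩ q ─ r - x        ≡⟨ x∉p⇒p-x≡p (λ x∈ → x∈p─q⇒x∉q x∈ x∈r) ⟩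
  p ∩ q ─ r            ∎

sumOver : Subset n → (Fin n → ℚ) → ℚ
sumOver {n} W g = sumFin n (λ v → if lookup W v then g v else 0ℚ)

sumOver-*ˡ : ∀ x (W : Subset n) g → x * sumOver W g ≡ sumOver W (λ v → x * g v)
sumOver-*ˡ x []            g = ℚ.*-zeroʳ x
sumOver-*ˡ x (inside ∷ W)  g =
  trans (ℚ.*-distribˡ-+ x _ _) (cong (x * g zero +_) (sumOver-*ˡ x W (g ∘ suc)))
sumOver-*ˡ x (outside ∷ W) g =
  trans (ℚ.*-distribˡ-+ x _ _) (cong₂ _+_ (ℚ.*-zeroʳ x) (sumOver-*ˡ x W (g ∘ suc)))

sumOver-const : ∀ (W : Subset n) {g y} → (∀ {v} → v ∈ W → g v ≡ y) → sumOver W g ≡ ℕ→ℚ ∣ W ∣ * y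
sumOver-const []            {y = y} _   = sym (ℚ.*-zeroˡ y)
sumOver-const (outside ∷ W) {g}     g≡y =
  trans (ℚ.+-identityˡ _) (sumOver-const W (g≡y ∘ there))
sumOver-const (inside ∷ W)  {g} {y} g≡y = begin
  g zero + sumOver W (g ∘ suc)   ≡⟨ cong₂ _+_ (g≡y here) (sumOver-const W (g≡y ∘ there)) ⟩
  y + ℕ→ℚ ∣ W ∣ * y              ≡⟨ solve 2 (λ y m → y :+ m :* y := (con 1ℚ :+ m) :* y) refl y (ℕ→ℚ ∣ W ∣) ⟩
  (1ℚ + ℕ→ℚ ∣ W ∣) * y           ≡⟨ cong (_* y) (sym (ℕ→ℚ-suc ∣ W ∣)) ⟩
  ℕ→ℚ (suc ∣ W ∣) * y            ∎

+-interchange : ∀ {x s : ℚ} y z s₁ s₂ → x ≡ y + z → s ≡ s₁ + s₂ → x + s ≡ (y + s₁) + (z + s₂)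
+-interchange y z s₁ s₂ refl refl =
  solve 4 (λ y z s₁ s₂ → (y :+ z) :+ (s₁ :+ s₂) := (y :+ s₁) :+ (z :+ s₂)) refl y z s₁ s₂

indicator-split : ∀ (p q : Subset (suc n)) x →
  (if lookup p zero then x else 0ℚ)
  ≡ (if lookup (p ∩ q) zero then x else 0ℚ) + (if lookup (p ─ q) zero then x else 0ℚ)
indicator-split (inside ∷ _)  (inside ∷ _)  x = sym (ℚ.+-identityʳ x)
indicator-split (inside ∷ _)  (outside ∷ _) x = sym (ℚ.+-identityˡ x)
indicator-split (outside ∷ _) (inside ∷ _)  x = refl
indicator-split (outside ∷ _) (outside ∷ _) x = refl

sumOver-split : ∀ (W P : Subset n) g → sumOver W g ≡ sumOver (W ∩ P) g + sumOver (W ─ P) g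
sumOver-split []      []      g = refl
sumOver-split (s ∷ W) (t ∷ P) g =
  +-interchange (head (_∩_)) (head (_─_)) (sumOver (W ∩ P) (g ∘ suc)) (sumOver (W ─ P) (g ∘ suc))
                (indicator-split (s ∷ W) (t ∷ P) (g zero)) (sumOver-split W P (g ∘ suc))
  where
  head : (Subset _ → Subset _ → Subset _) → ℚ
  head _op_ = if lookup ((s ∷ W) op (t ∷ P)) zero then g zero else 0ℚ

-- Inductive dimension

cliqueDim : ℕ → ℚ
cliqueDim k = -1ℚ + ℕ→ℚ k

1+cliqueDim : ∀ k → 1ℚ + cliqueDim k ≡ cliqueDim (suc k)
1+cliqueDim k = begin
  1ℚ + (-1ℚ + ℕ→ℚ k)   ≡⟨ solve 3 (λ a b x → a :+ (b :+ x) := b :+ (a :+ x)) refl 1ℚ -1ℚ (ℕ→ℚ k) ⟩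
  -1ℚ + (1ℚ + ℕ→ℚ k)   ≡⟨ cong (-1ℚ +_) (sym (ℕ→ℚ-suc k)) ⟩
  -1ℚ + ℕ→ℚ (suc k)    ∎

weightedCliqueDims : ℕ → ℕ → ℕ → ℕ → ℚ
weightedCliqueDims b c p q = ℕ→ℚ b * cliqueDim p + ℕ→ℚ c * cliqueDim q

weightedCliqueDims-suc : ∀ {b b′ c c′ p p′ q q′ D} → b′ ≡ b → c′ ≡ c → suc p′ ≡ p → suc q′ ≡ q →
  (ℕ→ℚ b′ + ℕ→ℚ c′) * D ≡ weightedCliqueDims b′ c′ p′ q′ →
  (ℕ→ℚ b + ℕ→ℚ c) * (1ℚ + D) ≡ weightedCliqueDims b c p q
weightedCliqueDims-suc {b} {c = c} {p′ = p} {q′ = q} {D = D} refl refl refl refl eq = begin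
  (B + C) * (1ℚ + D)
    ≡⟨ solve 3 (λ B C D → (B :+ C) :* (con 1ℚ :+ D) := (B :+ C) :+ (B :+ C) :* D) refl B C D ⟩
  (B + C) + (B + C) * D
    ≡⟨ cong ((B + C) +_) eq ⟩
  (B + C) + (B * X + C * Y)
    ≡⟨ solve 4 (λ B C X Y → (B :+ C) :+ (B :* X :+ C :* Y) := B :* (con 1ℚ :+ X) :+ C :* (con 1ℚ :+ Y))
               refl B C X Y ⟩
  B * (1ℚ + X) + C * (1ℚ + Y)
    ≡⟨ cong₂ (λ x y → B * x + C * y) (1+cliqueDim p) (1+cliqueDim q) ⟩
  weightedCliqueDims b c (suc p) (suc q) ∎
  where
  B = ℕ→ℚ b
  C = ℕ→ℚ c
  X = cliqueDim p
  Y = cliqueDim q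

module _ {n} (G : Graph n) where

  dimFuel-empty : ∀ f {W : Subset n} → ∣ W ∣ ≡ 0 → dimFuel f G W ≡ -1ℚ
  dimFuel-empty ℕ.zero    _  = refl
  dimFuel-empty (suc f) ∣W∣≡0 rewrite ∣W∣≡0 = refl

  dimFuel-suc : ∀ f {W : Subset n} {k} → ∣ W ∣ ≡ suc k →
    ℕ→ℚ (suc k) * dimFuel (suc f) G W ≡ sumOver W (λ v → 1ℚ + dimFuel f G (W ∩ nbhd G v))
  dimFuel-suc f {W} {k} ∣W∣≡ rewrite ∣W∣≡ = begin
    K * (S * r)   ≡⟨ solve 3 (λ K S r → K :* (S :* r) := (K :* r) :* S) refl K S r ⟩
    (K * r) * S   ≡⟨ cong (_* S) (ℕ→ℚ-suc-*-inverse k) ⟩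
    1ℚ * S        ≡⟨ ℚ.*-identityˡ S ⟩
    S             ∎
    where
    K = ℕ→ℚ (suc k)
    S = sumOver W (λ v → 1ℚ + dimFuel f G (W ∩ nbhd G v))
    r = ℤ.+ 1 / suc k

  dimFuel-induction : (P : Subset n → ℚ → Set) →
    (∀ {W} → ∣ W ∣ ≡ 0 → P W -1ℚ) →
    (∀ f {W k} → ∣ W ∣ ≡ suc k → ∣ W ∣ ≤ suc f →
       (∀ {U} → ∣ U ∣ ≤ f → P U (dimFuel f G U)) → P W (dimFuel (suc f) G W)) →
    ∀ f {W} → ∣ W ∣ ≤ f → P W (dimFuel f G W)
  dimFuel-induction P empty step ℕ.zero ∣W∣≤0 = empty (ℕ.n≤0⇒n≡0 ∣W∣≤0)
  dimFuel-induction P empty step (suc f) {W} ∣W∣≤ = by-size ∣ W ∣ refl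
    where
    by-size : ∀ m → ∣ W ∣ ≡ m → P W (dimFuel (suc f) G W)
    by-size ℕ.zero  ∣W∣≡0 = subst (P W) (sym (dimFuel-empty (suc f) {W} ∣W∣≡0)) (empty ∣W∣≡0)
    by-size (suc k) ∣W∣≡  = step f {W} ∣W∣≡ ∣W∣≤ (dimFuel-induction P empty step f)

  ∈-nbhd⁺ : ∀ {u v} → adj G v u ≡ true → u ∈ nbhd G v
  ∈-nbhd⁺ {u} {v} adj≡ = lookup⇒[]= u (nbhd G v) (trans (lookup∘tabulate (adj G v) u) adj≡)

  ∈-nbhd⁻ : ∀ {u v} → u ∈ nbhd G v → adj G v u ≡ true
  ∈-nbhd⁻ {u} {v} u∈ = trans (sym (lookup∘tabulate (adj G v) u)) ([]=⇒lookup u∈)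

  adj⇒≢ : ∀ {u v} → adj G v u ≡ true → u ≢ v
  adj⇒≢ {v = v} adj≡ refl = contradiction (trans (sym adj≡) (irrefl G v)) λ ()

  IsClique-⊆ : ∀ {C D} → D ⊆ C → IsClique G C → IsClique G D
  IsClique-⊆ D⊆C C-clique u v u∈D v∈D = C-clique u v (D⊆C u∈D) (D⊆C v∈D)

  ∩-nbhd-universal : ∀ {W v} → (∀ {u} → u ∈ W → u ≢ v → adj G v u ≡ true) → W ∩ nbhd G v ≡ W - v
  ∩-nbhd-universal {W} {v} universal = ⊆-antisym to from
    where
    to : W ∩ nbhd G v ⊆ W - v
    to u∈ with x∈p∩q⁻ W (nbhd G v) u∈
    ... | u∈W , u∈N = x∈p∧x≢y⇒x∈p-y u∈W (adj⇒≢ (∈-nbhd⁻ u∈N))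
    from : W - v ⊆ W ∩ nbhd G v
    from u∈ = x∈p∩q⁺ (u∈W , ∈-nbhd⁺ (universal u∈W (x∈p-y⇒x≢y u∈)))
      where u∈W = p─q⊆p W ⁅ v ⁆ u∈

  ∩-nbhd-private : ∀ {Vᵢ Vⱼ W v} → IsClique G Vᵢ →
    (∀ u w → adj G u w ≡ true → (u ∈ Vᵢ × w ∈ Vᵢ) ⊎ (u ∈ Vⱼ × w ∈ Vⱼ)) →
    v ∈ Vᵢ → v ∉ Vⱼ → W ∩ nbhd G v ≡ (W ∩ Vᵢ) - v
  ∩-nbhd-private {Vᵢ} {Vⱼ} {W} {v} Vᵢ-clique edges v∈Vᵢ v∉Vⱼ = ⊆-antisym to from
    where
    to : W ∩ nbhd G v ⊆ (W ∩ Vᵢ) - v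
    to {u} u∈ with x∈p∩q⁻ W (nbhd G v) u∈
    ... | u∈W , u∈N with edges v u (∈-nbhd⁻ u∈N)
    ...   | inj₁ (_ , u∈Vᵢ) = x∈p∧x≢y⇒x∈p-y (x∈p∩q⁺ (u∈W , u∈Vᵢ)) (adj⇒≢ (∈-nbhd⁻ u∈N))
    ...   | inj₂ (v∈Vⱼ , _) = contradiction v∈Vⱼ v∉Vⱼ
    from : (W ∩ Vᵢ) - v ⊆ W ∩ nbhd G v
    from {u} u∈ with x∈p∩q⁻ W Vᵢ (p─q⊆p (W ∩ Vᵢ) ⁅ v ⁆ u∈)
    ... | u∈W , u∈Vᵢ = x∈p∩q⁺ (u∈W , ∈-nbhd⁺ (Vᵢ-clique v u v∈Vᵢ u∈Vᵢ (≢-sym (x∈p-y⇒x≢y u∈))))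

  clique-minus-dim : ∀ f {C v} →
    (∀ {D} → ∣ D ∣ ≤ f → IsClique G D → dimFuel f G D ≡ cliqueDim ∣ D ∣) →
    IsClique G C → v ∈ C → ∣ C ∣ ≤ suc f → 1ℚ + dimFuel f G (C - v) ≡ cliqueDim ∣ C ∣
  clique-minus-dim f {C} {v} clique-dim C-clique v∈C ∣C∣≤ = begin
    1ℚ + dimFuel f G (C - v)
      ≡⟨ cong (1ℚ +_) (clique-dim (x∈p∧∣p∣≤1+m⇒∣p-x∣≤m v∈C ∣C∣≤) (IsClique-⊆ (p─q⊆p C ⁅ v ⁆) C-clique)) ⟩
    1ℚ + cliqueDim ∣ C - v ∣    ≡⟨ 1+cliqueDim ∣ C - v ∣ ⟩
    cliqueDim (suc ∣ C - v ∣)   ≡⟨ cong cliqueDim (x∈p⇒suc∣p-x∣≡∣p∣ v∈C) ⟩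
    cliqueDim ∣ C ∣             ∎

  clique-dim : ∀ f {C} → ∣ C ∣ ≤ f → IsClique G C → dimFuel f G C ≡ cliqueDim ∣ C ∣
  clique-dim = dimFuel-induction (λ C d → IsClique G C → d ≡ cliqueDim ∣ C ∣) empty step
    where
    empty : ∀ {C} → ∣ C ∣ ≡ 0 → IsClique G C → -1ℚ ≡ cliqueDim ∣ C ∣
    empty ∣C∣≡0 _ rewrite ∣C∣≡0 = refl
    step : ∀ f {C k} → ∣ C ∣ ≡ suc k → ∣ C ∣ ≤ suc f →
      (∀ {D} → ∣ D ∣ ≤ f → IsClique G D → dimFuel f G D ≡ cliqueDim ∣ D ∣) →
      IsClique G C → dimFuel (suc f) G C ≡ cliqueDim ∣ C ∣
    step f {C} {k} ∣C∣≡ ∣C∣≤ clique-dim C-clique = ℕ→ℚ-suc-*-cancelˡ k (begin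
      ℕ→ℚ (suc k) * dimFuel (suc f) G C                        ≡⟨ dimFuel-suc f ∣C∣≡ ⟩
      sumOver C (λ v → 1ℚ + dimFuel f G (C ∩ nbhd G v))        ≡⟨ sumOver-const C vertex ⟩
      ℕ→ℚ ∣ C ∣ * cliqueDim ∣ C ∣                               ≡⟨ cong (_* cliqueDim ∣ C ∣) (cong ℕ→ℚ ∣C∣≡) ⟩
      ℕ→ℚ (suc k) * cliqueDim ∣ C ∣                             ∎)
      where
      vertex : ∀ {v} → v ∈ C → 1ℚ + dimFuel f G (C ∩ nbhd G v) ≡ cliqueDim ∣ C ∣
      vertex {v} v∈C = begin
        1ℚ + dimFuel f G (C ∩ nbhd G v)
          ≡⟨ cong (λ X → 1ℚ + dimFuel f G X) (∩-nbhd-universal λ u∈C u≢v → C-clique _ _ v∈C u∈C (≢-sym u≢v)) ⟩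
        1ℚ + dimFuel f G (C - v)
          ≡⟨ clique-minus-dim f clique-dim C-clique v∈C ∣C∣≤ ⟩
        cliqueDim ∣ C ∣ ∎

  private-vertex-dim : ∀ f {Vᵢ Vⱼ W v} → IsClique G Vᵢ →
    (∀ u w → adj G u w ≡ true → (u ∈ Vᵢ × w ∈ Vᵢ) ⊎ (u ∈ Vⱼ × w ∈ Vⱼ)) →
    v ∈ W ∩ Vᵢ ─ Vⱼ → ∣ W ∣ ≤ suc f → 1ℚ + dimFuel f G (W ∩ nbhd G v) ≡ cliqueDim ∣ W ∩ Vᵢ ∣
  private-vertex-dim f {Vᵢ} {Vⱼ} {W} {v} Vᵢ-clique edges v∈ ∣W∣≤ = begin
    1ℚ + dimFuel f G (W ∩ nbhd G v)
      ≡⟨ cong (λ X → 1ℚ + dimFuel f G X) (∩-nbhd-private Vᵢ-clique edges v∈Vᵢ (x∈p─q⇒x∉q v∈)) ⟩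
    1ℚ + dimFuel f G ((W ∩ Vᵢ) - v)
      ≡⟨ clique-minus-dim f (clique-dim f) (IsClique-⊆ (p∩q⊆q W Vᵢ) Vᵢ-clique) v∈W∩Vᵢ
                          (ℕ.≤-trans (∣p∩q∣≤∣p∣ W Vᵢ) ∣W∣≤) ⟩
    cliqueDim ∣ W ∩ Vᵢ ∣ ∎
    where
    v∈W∩Vᵢ = p─q⊆p (W ∩ Vᵢ) Vⱼ v∈
    v∈Vᵢ = proj₂ (x∈p∩q⁻ W Vᵢ v∈W∩Vᵢ)

complete-adj : ∀ {n} {u v : Fin n} → u ≢ v → adj (complete n) u v ≡ true
complete-adj {u = zero}  {zero}  u≢v = contradiction refl u≢v
complete-adj {u = zero}  {suc _} _   = refl
complete-adj {u = suc _} {zero}  _   = refl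
complete-adj {u = suc u} {suc v} u≢v = complete-adj (u≢v ∘ cong suc)

dimK≡cliqueDim : ∀ (V : Subset n) → dimK V ≡ cliqueDim ∣ V ∣
dimK≡cliqueDim {n} V = clique-dim (complete n) n (∣p∣≤n V) (λ _ _ _ _ → complete-adj)

-- Two cliques covering a graph

module TwoCliques {n} (G : Graph n) {V₁ V₂ : Subset n}
  (V₁-clique : IsClique G V₁) (V₂-clique : IsClique G V₂)
  (cover : ∀ v → v ∈ V₁ ⊎ v ∈ V₂)
  (edges : ∀ u v → adj G u v ≡ true → (u ∈ V₁ × v ∈ V₁) ⊎ (u ∈ V₂ × v ∈ V₂)) where

  both only₁ only₂ : Subset n → ℕ
  both W  = ∣ (W ∩ V₁) ∩ V₂ ∣
  only₁ W = ∣ W ∩ V₁ ─ V₂ ∣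
  only₂ W = ∣ W ∩ V₂ ─ V₁ ∣

  W─V₁≡W∩V₂─V₁ : ∀ W → W ─ V₁ ≡ W ∩ V₂ ─ V₁
  W─V₁≡W∩V₂─V₁ W = ⊆-antisym to from
    where
    to : W ─ V₁ ⊆ W ∩ V₂ ─ V₁
    to {u} u∈ with cover u
    ... | inj₁ u∈V₁ = contradiction u∈V₁ (x∈p─q⇒x∉q u∈)
    ... | inj₂ u∈V₂ = x∈p∧x∉q⇒x∈p─q (x∈p∩q⁺ (p─q⊆p W V₁ u∈ , u∈V₂)) (x∈p─q⇒x∉q u∈)
    from : W ∩ V₂ ─ V₁ ⊆ W ─ V₁
    from u∈ = x∈p∧x∉q⇒x∈p─q (proj₁ (x∈p∩q⁻ W V₂ (p─q⊆p (W ∩ V₂) V₁ u∈))) (x∈p─q⇒x∉q u∈)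

  size-parts : ∀ W → ∣ W ∣ ≡ both W ℕ.+ only₁ W ℕ.+ only₂ W
  size-parts W = begin
    ∣ W ∣                                ≡⟨ ∣p∣≡∣p∩q∣+∣p─q∣ W V₁ ⟩
    ∣ W ∩ V₁ ∣ ℕ.+ ∣ W ─ V₁ ∣
      ≡⟨ cong₂ ℕ._+_ (∣p∣≡∣p∩q∣+∣p─q∣ (W ∩ V₁) V₂) (cong ∣_∣ (W─V₁≡W∩V₂─V₁ W)) ⟩
    both W ℕ.+ only₁ W ℕ.+ only₂ W       ∎

  sumOver-parts : ∀ W g →
    sumOver W g ≡ sumOver ((W ∩ V₁) ∩ V₂) g + sumOver (W ∩ V₁ ─ V₂) g + sumOver (W ∩ V₂ ─ V₁) g
  sumOver-parts W g = begin
    sumOver W g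
      ≡⟨ sumOver-split W V₁ g ⟩
    sumOver (W ∩ V₁) g + sumOver (W ─ V₁) g
      ≡⟨ cong₂ _+_ (sumOver-split (W ∩ V₁) V₂ g) (cong (λ X → sumOver X g) (W─V₁≡W∩V₂─V₁ W)) ⟩
    sumOver ((W ∩ V₁) ∩ V₂) g + sumOver (W ∩ V₁ ─ V₂) g + sumOver (W ∩ V₂ ─ V₁) g ∎

  weight : Subset n → ℚ
  weight W = ℕ→ℚ (only₁ W) + ℕ→ℚ (only₂ W)

  target : Subset n → ℚ
  target W = weightedCliqueDims (only₁ W) (only₂ W) ∣ W ∩ V₁ ∣ ∣ W ∩ V₂ ∣

  shared-vertex : ∀ f {W v} → v ∈ (W ∩ V₁) ∩ V₂ → ∣ W ∣ ≤ suc f →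
    (∀ {U} → ∣ U ∣ ≤ f → weight U * dimFuel f G U ≡ target U) →
    weight W * (1ℚ + dimFuel f G (W ∩ nbhd G v)) ≡ target W
  shared-vertex f {W} {v} v∈ ∣W∣≤ weight*dimFuel≡target = begin
    weight W * (1ℚ + dimFuel f G (W ∩ nbhd G v))
      ≡⟨ cong (λ X → weight W * (1ℚ + dimFuel f G X)) (∩-nbhd-universal G universal) ⟩
    weight W * (1ℚ + dimFuel f G (W - v))
      ≡⟨ weightedCliqueDims-suc (cong ∣_∣ (x∈r⇒[p-x]∩q─r≡p∩q─r W V₁ V₂ v∈V₂))
                                (cong ∣_∣ (x∈r⇒[p-x]∩q─r≡p∩q─r W V₂ V₁ v∈V₁))
                                (x∈p∩q⇒suc∣[p-x]∩q∣≡∣p∩q∣ W V₁ v∈W∩V₁)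
                                (x∈p∩q⇒suc∣[p-x]∩q∣≡∣p∩q∣ W V₂ (x∈p∩q⁺ (v∈W , v∈V₂)))
                                (weight*dimFuel≡target {W - v} (x∈p∧∣p∣≤1+m⇒∣p-x∣≤m v∈W ∣W∣≤)) ⟩
    target W ∎
    where
    v∈W∩V₁ = proj₁ (x∈p∩q⁻ (W ∩ V₁) V₂ v∈)
    v∈V₂   = proj₂ (x∈p∩q⁻ (W ∩ V₁) V₂ v∈)
    v∈W    = proj₁ (x∈p∩q⁻ W V₁ v∈W∩V₁)
    v∈V₁   = proj₂ (x∈p∩q⁻ W V₁ v∈W∩V₁)
    universal : ∀ {u} → u ∈ W → u ≢ v → adj G v u ≡ true
    universal {u} _ u≢v with cover u
    ... | inj₁ u∈V₁ = V₁-clique v u v∈V₁ u∈V₁ (≢-sym u≢v)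
    ... | inj₂ u∈V₂ = V₂-clique v u v∈V₂ u∈V₂ (≢-sym u≢v)

  weight*dimFuel≡target : ∀ f {W} → ∣ W ∣ ≤ f → weight W * dimFuel f G W ≡ target W
  weight*dimFuel≡target = dimFuel-induction G (λ W d → weight W * d ≡ target W) (λ {W} → empty {W}) step
    where
    empty : ∀ {W} → ∣ W ∣ ≡ 0 → weight W * -1ℚ ≡ target W
    empty {W} ∣W∣≡0 = begin
      weight W * -1ℚ    ≡⟨ cong₂ (λ b c → (ℕ→ℚ b + ℕ→ℚ c) * -1ℚ) only₁≡0 only₂≡0 ⟩
      0ℚ                ≡⟨ cong₂ _+_ (ℚ.*-zeroˡ X) (ℚ.*-zeroˡ Y) ⟨
      0ℚ * X + 0ℚ * Y   ≡⟨ cong₂ (λ b c → ℕ→ℚ b * X + ℕ→ℚ c * Y) only₁≡0 only₂≡0 ⟨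
      target W          ∎
      where
      parts≡0 : both W ℕ.+ only₁ W ℕ.+ only₂ W ≡ 0
      parts≡0 = trans (sym (size-parts W)) ∣W∣≡0
      only₁≡0 : only₁ W ≡ 0
      only₁≡0 = ℕ.m+n≡0⇒n≡0 (both W) (ℕ.m+n≡0⇒m≡0 (both W ℕ.+ only₁ W) parts≡0)
      only₂≡0 : only₂ W ≡ 0
      only₂≡0 = ℕ.m+n≡0⇒n≡0 (both W ℕ.+ only₁ W) parts≡0
      X = cliqueDim ∣ W ∩ V₁ ∣
      Y = cliqueDim ∣ W ∩ V₂ ∣
    step : ∀ f {W k} → ∣ W ∣ ≡ suc k → ∣ W ∣ ≤ suc f →
      (∀ {U} → ∣ U ∣ ≤ f → weight U * dimFuel f G U ≡ target U) →
      weight W * dimFuel (suc f) G W ≡ target W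
    step f {W} {k} ∣W∣≡ ∣W∣≤ weight*dimFuel≡target = ℕ→ℚ-suc-*-cancelˡ k (begin
      ℕ→ℚ (suc k) * (weight W * dimFuel (suc f) G W)
        ≡⟨ solve 3 (λ K w d → K :* (w :* d) := w :* (K :* d)) refl (ℕ→ℚ (suc k)) (weight W) _ ⟩
      weight W * (ℕ→ℚ (suc k) * dimFuel (suc f) G W)
        ≡⟨ cong (weight W *_) (dimFuel-suc G f ∣W∣≡) ⟩
      weight W * sumOver W D
        ≡⟨ sumOver-*ˡ (weight W) W D ⟩
      sumOver W (λ v → weight W * D v)
        ≡⟨ sumOver-parts W _ ⟩
      sumOver ((W ∩ V₁) ∩ V₂) _ + sumOver (W ∩ V₁ ─ V₂) _ + sumOver (W ∩ V₂ ─ V₁) _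
        ≡⟨ cong₂ _+_ (cong₂ _+_ (sumOver-const _ shared) (sumOver-const _ private₁))
                     (sumOver-const _ private₂) ⟩
      A * target W + B * (weight W * X) + C * (weight W * Y)
        ≡⟨ solve 5 (λ A B C X Y → A :* (B :* X :+ C :* Y) :+ B :* ((B :+ C) :* X) :+ C :* ((B :+ C) :* Y)
                                := (A :+ B :+ C) :* (B :* X :+ C :* Y)) refl A B C X Y ⟩
      (A + B + C) * target W
        ≡⟨ cong (_* target W) (trans (ℕ→ℚ-+ (both W ℕ.+ only₁ W) (only₂ W))
                                     (cong (_+ C) (ℕ→ℚ-+ (both W) (only₁ W)))) ⟨
      ℕ→ℚ (both W ℕ.+ only₁ W ℕ.+ only₂ W) * target W
        ≡⟨ cong (λ m → ℕ→ℚ m * target W) (trans (sym (size-parts W)) ∣W∣≡) ⟩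
      ℕ→ℚ (suc k) * target W ∎)
      where
      D : Fin n → ℚ
      D v = 1ℚ + dimFuel f G (W ∩ nbhd G v)
      A = ℕ→ℚ (both W)
      B = ℕ→ℚ (only₁ W)
      C = ℕ→ℚ (only₂ W)
      X = cliqueDim ∣ W ∩ V₁ ∣
      Y = cliqueDim ∣ W ∩ V₂ ∣
      shared : ∀ {v} → v ∈ (W ∩ V₁) ∩ V₂ → weight W * D v ≡ target W
      shared v∈ = shared-vertex f {W} v∈ ∣W∣≤ (λ {U} → weight*dimFuel≡target {U})
      private₁ : ∀ {v} → v ∈ W ∩ V₁ ─ V₂ → weight W * D v ≡ weight W * X
      private₁ v∈ = cong (weight W *_) (private-vertex-dim G f V₁-clique edges v∈ ∣W∣≤)
      private₂ : ∀ {v} → v ∈ W ∩ V₂ ─ V₁ → weight W * D v ≡ weight W * Y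
      private₂ v∈ =
        cong (weight W *_) (private-vertex-dim G f V₂-clique (λ u w → ⊎-swap ∘ edges u w) v∈ ∣W∣≤)

  dim-formula : (ℕ→ℚ ∣ V₁ ─ V₂ ∣ + ℕ→ℚ ∣ V₂ ─ V₁ ∣) * dim G
                ≡ weightedCliqueDims (∣ V₁ ─ V₂ ∣) (∣ V₂ ─ V₁ ∣) (∣ V₁ ∣) (∣ V₂ ∣)
  dim-formula = begin
    (ℕ→ℚ ∣ V₁ ─ V₂ ∣ + ℕ→ℚ ∣ V₂ ─ V₁ ∣) * dim G
      ≡⟨ ⊤∩ (λ X Y → (ℕ→ℚ ∣ X ─ V₂ ∣ + ℕ→ℚ ∣ Y ─ V₁ ∣) * dim G) ⟨
    weight ⊤ * dim G
      ≡⟨ weight*dimFuel≡target n {⊤} (∣p∣≤n ⊤) ⟩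
    target ⊤
      ≡⟨ ⊤∩ (λ X Y → weightedCliqueDims (∣ X ─ V₂ ∣) (∣ Y ─ V₁ ∣) (∣ X ∣) (∣ Y ∣)) ⟩
    weightedCliqueDims (∣ V₁ ─ V₂ ∣) (∣ V₂ ─ V₁ ∣) (∣ V₁ ∣) (∣ V₂ ∣) ∎
    where
    ⊤∩ : (F : Subset n → Subset n → ℚ) → F (⊤ ∩ V₁) (⊤ ∩ V₂) ≡ F V₁ V₂
    ⊤∩ F = cong₂ F (∩-identityˡ V₁) (∩-identityˡ V₂)

  n∸∣V₁∩V₂∣≡∣V₁─V₂∣+∣V₂─V₁∣ : n ∸ ∣ V₁ ∩ V₂ ∣ ≡ ∣ V₁ ─ V₂ ∣ ℕ.+ ∣ V₂ ─ V₁ ∣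
  n∸∣V₁∩V₂∣≡∣V₁─V₂∣+∣V₂─V₁∣ = begin
    n ∸ ∣ V₁ ∩ V₂ ∣                                              ≡⟨ cong (_∸ ∣ V₁ ∩ V₂ ∣) n≡ ⟩
    ∣ V₁ ∩ V₂ ∣ ℕ.+ (∣ V₁ ─ V₂ ∣ ℕ.+ ∣ V₂ ─ V₁ ∣) ∸ ∣ V₁ ∩ V₂ ∣   ≡⟨ ℕ.m+n∸m≡n ∣ V₁ ∩ V₂ ∣ _ ⟩
    ∣ V₁ ─ V₂ ∣ ℕ.+ ∣ V₂ ─ V₁ ∣                                  ∎
    where
    n≡ : n ≡ ∣ V₁ ∩ V₂ ∣ ℕ.+ (∣ V₁ ─ V₂ ∣ ℕ.+ ∣ V₂ ─ V₁ ∣)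
    n≡ = begin
      n                                       ≡⟨ ∣⊤∣≡n n ⟨
      ∣ ⊤ {n} ∣                               ≡⟨ size-parts ⊤ ⟩
      both ⊤ ℕ.+ only₁ ⊤ ℕ.+ only₂ ⊤          ≡⟨ ℕ.+-assoc (both ⊤) _ _ ⟩
      both ⊤ ℕ.+ (only₁ ⊤ ℕ.+ only₂ ⊤)
        ≡⟨ cong₂ (λ X Y → ∣ X ∩ V₂ ∣ ℕ.+ (∣ X ─ V₂ ∣ ℕ.+ ∣ Y ─ V₁ ∣)) (∩-identityˡ V₁) (∩-identityˡ V₂) ⟩
      ∣ V₁ ∩ V₂ ∣ ℕ.+ (∣ V₁ ─ V₂ ∣ ℕ.+ ∣ V₂ ─ V₁ ∣) ∎

lemma3 : ∀ {n : ℕ} (G : Graph n) (V₁ V₂ : Subset n)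
    → EdgeCliqueCoverNumber G 2
    → IsMaximalClique G V₁
    → IsMaximalClique G V₂
    → (∀ (v : Fin n) → v ∈ V₁ ⊎ v ∈ V₂)
    → (∀ (u v : Fin n) → adj G u v ≡ true → (u ∈ V₁ × v ∈ V₁) ⊎ (u ∈ V₂ × v ∈ V₂))
    → ℕ→ℚ (n ∸ ∣ V₁ ∩ V₂ ∣) * dim G
      ≡ ℕ→ℚ ∣ V₁ ─ V₂ ∣ * dimK V₁ + ℕ→ℚ ∣ V₂ ─ V₁ ∣ * dimK V₂
lemma3 {n} G V₁ V₂ _ (V₁-clique , _) (V₂-clique , _) cover edges = begin
  ℕ→ℚ (n ∸ ∣ V₁ ∩ V₂ ∣) * dim G
    ≡⟨ cong (λ m → ℕ→ℚ m * dim G) n∸∣V₁∩V₂∣≡∣V₁─V₂∣+∣V₂─V₁∣ ⟩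
  ℕ→ℚ (∣ V₁ ─ V₂ ∣ ℕ.+ ∣ V₂ ─ V₁ ∣) * dim G
    ≡⟨ cong (_* dim G) (ℕ→ℚ-+ ∣ V₁ ─ V₂ ∣ ∣ V₂ ─ V₁ ∣) ⟩
  (ℕ→ℚ ∣ V₁ ─ V₂ ∣ + ℕ→ℚ ∣ V₂ ─ V₁ ∣) * dim G
    ≡⟨ dim-formula ⟩
  weightedCliqueDims (∣ V₁ ─ V₂ ∣) (∣ V₂ ─ V₁ ∣) (∣ V₁ ∣) (∣ V₂ ∣)
    ≡⟨ cong₂ (λ x y → ℕ→ℚ ∣ V₁ ─ V₂ ∣ * x + ℕ→ℚ ∣ V₂ ─ V₁ ∣ * y) (dimK≡cliqueDim V₁) (dimK≡cliqueDim V₂) ⟨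
  ℕ→ℚ ∣ V₁ ─ V₂ ∣ * dimK V₁ + ℕ→ℚ ∣ V₂ ─ V₁ ∣ * dimK V₂ ∎
  where open TwoCliques G V₁-clique V₂-clique cover edges
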